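{- For every integer $q\ge 0$, every minimum $\sigma$-$\tau$ edge cut in the $q$-triangle fractal $\triangle_q$ contains exactly one edge of each boundary $B_0,B_1,\dots,B_q$.
   Context: The $q$-triangle fractal $\triangle_q$ is built as follows: start with two vertices $\sigma,\tau$ joined by one edge, which is marked. Then repeat $q$ times: for every currently marked edge $\{a,b\}$ add a new vertex $w$ and the two new edges $\{a,w\},\{w,b\}$, mark these new edges, and unmark all previously marked edges. The boundary $B_0$ is the set $\{\{\sigma,\tau\}\}$, and for $i\in\{1,\dots,q\}$ the boundary $B_i$ is the set of edges added in the $i$-th repetition. (Each $B_i$ forms a $\sigma$-$\tau$ path and the boundaries are pairwise edge-disjoint.) A minimum $\sigma$-$\tau$ edge cut is an edge set of minimum cardinality whose removal disconnects $\sigma$ from $\tau$. -}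

module Defs where

open import Data.Nat using (ℕ; zero; suc; _≤_)
open import Data.Product using (_×_; _,_; proj₁; proj₂; ∃)
open import Data.List using (List; []; _∷_; _++_; length)
open import Data.List.Membership.Propositional using (_∈_; _∉_)
open import Data.List.Relation.Unary.Unique.Propositional using (Unique)
open import Relation.Binary.PropositionalEquality using (_≡_)
open import Relation.Nullary using (¬_)

-- Vertices are natural numbers: σ = 0, τ = 1, and new vertices are
-- numbered 2, 3, 4, ... in order of creation.
-- An edge {a,b} is stored as the ordered pair (a , b) in the orientation
-- in which it was created; the graph has no parallel edges.
Vertex : Set
Vertex = ℕ

Edge : Set
Edge = Vertex × Vertex

σ τ : Vertex
σ = 0
τ = 1

-- One repetition of the construction applied to the list of marked edges:
-- given the next fresh vertex number n, every marked edge (a , b) gets a new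
-- vertex w and is replaced (as marked edge) by the two new edges (a , w), (w , b).
subdivide : ℕ → List Edge → ℕ × List Edge
subdivide n [] = n , []
subdivide n ((a , b) ∷ es) with subdivide (suc n) es
... | m , es' = m , ((a , n) ∷ (n , b) ∷ es')

-- State after i repetitions: (next fresh vertex, currently marked edges).
stage : ℕ → ℕ × List Edge
stage zero = 2 , ((σ , τ) ∷ [])
stage (suc i) = subdivide (proj₁ (stage i)) (proj₂ (stage i))

-- Boundary B_i: B_0 = {{σ,τ}}, B_i = edges added in the i-th repetition
-- (= the marked edges after i repetitions).  It does not depend on q ≥ i.
B : ℕ → List Edge
B i = proj₂ (stage i)

edges : ℕ → List Edge
edges zero = B zero
edges (suc q) = edges q ++ B (suc q)

data Reach (E C : List Edge) : Vertex → Vertex → Set where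
  here  : ∀ {x} → Reach E C x x
  fwd   : ∀ {x y z} → (x , y) ∈ E → (x , y) ∉ C → Reach E C y z → Reach E C x z
  bwd   : ∀ {x y z} → (y , x) ∈ E → (y , x) ∉ C → Reach E C y z → Reach E C x z

IsCut : ℕ → List Edge → Set
IsCut q C = Unique C × (∀ {e} → e ∈ C → e ∈ edges q) × ¬ Reach (edges q) C σ τ

IsMinCut : ℕ → List Edge → Set
IsMinCut q C = IsCut q C × (∀ D → IsCut q D → length C ≤ length D)

ExactlyOneOf : List Edge → List Edge → Set
ExactlyOneOf C S = ∃ λ e → e ∈ C × e ∈ S × (∀ {e'} → e' ∈ C → e' ∈ S → e' ≡ e)

module Submission where

-- The argument combines three facts about the construction with one piece
-- of counting.
--   * The boundaries are pairwise disjoint: every vertex of B_i is older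
--     than the fresh vertex counter after stage i, while every edge of a
--     later boundary has an endpoint created after that stage.
--   * Each boundary is a σ-τ walk inside △_q, so every cut meets each of
--     the q+1 boundaries.
--   * The first edges of B_0, …, B_q are exactly the edges at σ; removing
--     these q+1 edges isolates σ, so a minimum cut has at most q+1 edges.
-- Counting: a list meeting k pairwise disjoint sets has length at least k,
-- and if its length is at most k it meets each set in only one element.

open import Defs
open import Data.Nat using (ℕ; _≤_)
open import Data.List using (List)

open import Data.Nat using (zero; suc; _+_; _<_; z≤n; s≤s; s≤s⁻¹; _≤′_; ≤′-refl; ≤′-step)
open import Data.Nat.Properties
  using (_≟_; ≤-refl; ≤-trans; <-≤-trans; <-trans; <-irrefl;
         n≤1+n; m≤n⇒m≤1+n; <-cmp; +-suc; ≤⇒≤′; 1+n≰n)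
open import Data.Product using (_×_; _,_; proj₁; proj₂; ∃)
open import Data.Product.Properties using (≡-dec)
open import Data.Sum using (_⊎_; inj₁; inj₂)
open import Data.Empty using (⊥; ⊥-elim)
open import Data.List using ([]; _∷_; _++_; length)
open import Data.List.Properties using (length-++)
open import Data.List.Relation.Unary.All as All using (All; []; _∷_)
open import Data.List.Relation.Unary.Any using (here; there)
open import Data.List.Relation.Unary.AllPairs using ([]; _∷_)
open import Data.List.Membership.Propositional using (_∈_)
open import Data.List.Membership.Propositional.Properties
  using (∈-++⁺ˡ; ∈-++⁺ʳ; ∈-++⁻; ∈-∃++)
open import Data.List.Relation.Unary.Unique.Propositional using (Unique)
open import Relation.Binary.PropositionalEquality
  using (_≡_; _≢_; refl; sym; cong; subst; module ≡-Reasoning)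
open import Relation.Nullary using (¬_; yes; no)
open import Relation.Binary using (DecidableEquality; tri<; tri≈; tri>)

delete : ∀ {A : Set} {v : A} {xs : List A} → v ∈ xs →
         ∃ λ ys → length xs ≡ suc (length ys) × (∀ {y} → y ∈ xs → y ≢ v → y ∈ ys)
delete {v = v} {xs} v∈xs with ∈-∃++ v∈xs
... | ys , zs , refl = ys ++ zs , shorter , kept
  where
  open ≡-Reasoning
  shorter : length (ys ++ v ∷ zs) ≡ suc (length (ys ++ zs))
  shorter = begin
    length (ys ++ v ∷ zs)          ≡⟨ length-++ ys ⟩
    length ys + suc (length zs)    ≡⟨ +-suc (length ys) (length zs) ⟩
    suc (length ys + length zs)    ≡⟨ cong suc (sym (length-++ ys)) ⟩
    suc (length (ys ++ zs))        ∎
  kept : ∀ {y} → y ∈ ys ++ v ∷ zs → y ≢ v → y ∈ ys ++ zs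
  kept y∈ y≢v with ∈-++⁻ ys y∈
  ... | inj₁ y∈ys          = ∈-++⁺ˡ y∈ys
  ... | inj₂ (here y≡v)    = ⊥-elim (y≢v y≡v)
  ... | inj₂ (there y∈zs)  = ∈-++⁺ʳ ys y∈zs

module DisjointFamily {A : Set} (_≟ᴬ_ : DecidableEquality A) (S : ℕ → A → Set)
  (disjoint< : ∀ {i j x} → i < j → S i x → S j x → ⊥) where

  disjoint : ∀ {i j x} → i ≢ j → S i x → S j x → ⊥
  disjoint {i} {j} i≢j x∈Si x∈Sj with <-cmp i j
  ... | tri< i<j _ _ = disjoint< i<j x∈Si x∈Sj
  ... | tri≈ _ i≡j _ = i≢j i≡j
  ... | tri> _ _ j<i = disjoint< j<i x∈Sj x∈Si

  Meets : ℕ → List A → Set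
  Meets k X = ∀ j → j < k → ∃ λ x → x ∈ X × S j x

  -- Distinct sets of the family need distinct representatives.
  meets⇒long : ∀ k X → Meets k X → k ≤ length X
  meets⇒long zero    X meets = z≤n
  meets⇒long (suc k) X meets with meets k ≤-refl
  ... | x , x∈X , x∈Sk with delete x∈X
  ...   | Y , len , kept =
    subst (suc k ≤_) (sym len) (s≤s (meets⇒long k Y meetsY))
    where
    meetsY : Meets k Y
    meetsY j j<k with meets j (m≤n⇒m≤1+n j<k)
    ... | y , y∈X , y∈Sj = y , kept y∈X (λ { refl → disjoint< j<k y∈Sj x∈Sk }) , y∈Sj

  -- A list of length at most k meeting S 0, …, S (k-1) meets each of them
  -- in a single element: a second one could be deleted, leaving a list of
  -- length below k that still meets all k sets.
  tight⇒single : ∀ k X → Meets k X → length X ≤ k →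
                 ∀ {i x y} → i < k → x ∈ X → S i x → y ∈ X → S i y → y ≡ x
  tight⇒single k X meets short {i} {x} {y} i<k x∈X x∈Si y∈X y∈Si with y ≟ᴬ x
  ... | yes y≡x = y≡x
  ... | no  y≢x with delete y∈X
  ...   | Y , len , kept =
    ⊥-elim (1+n≰n (subst (_≤ length Y) len (≤-trans short (meets⇒long k Y meetsY))))
    where
    meetsY : Meets k Y
    meetsY j j<k with j ≟ i
    ... | yes refl = x , kept x∈X (λ x≡y → y≢x (sym x≡y)) , x∈Si
    ... | no  j≢i with meets j j<k
    ...   | z , z∈X , z∈Sj = z , kept z∈X (λ { refl → disjoint j≢i z∈Sj y∈Si }) , z∈Sj

Below : ℕ → List Edge → Set
Below m es = All (λ e → proj₁ e < m × proj₂ e < m) es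

Touches : ℕ → List Edge → Set
Touches n es = All (λ e → n ≤ proj₁ e ⊎ n ≤ proj₂ e) es

Walk : Vertex → List Edge → Vertex → Set
Walk x []             y = x ≡ y
Walk x ((a , b) ∷ es) y = x ≡ a × Walk b es y

Avoidsσ : Edge → Set
Avoidsσ (x , y) = x ≢ σ × y ≢ σ

σOnlyFirst : List Edge → Set
σOnlyFirst []             = ⊥
σOnlyFirst ((a , b) ∷ es) = b ≢ σ × All Avoidsσ es

below-weaken : ∀ {m m' es} → m ≤ m' → Below m es → Below m' es
below-weaken m≤m' = All.map (λ { (a<m , b<m) → <-≤-trans a<m m≤m' , <-≤-trans b<m m≤m' })

touches-weaken : ∀ {n n' es} → n ≤ n' → Touches n' es → Touches n es
touches-weaken n≤n' = All.map λ { (inj₁ n'≤a) → inj₁ (≤-trans n≤n' n'≤a)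
                                ; (inj₂ n'≤b) → inj₂ (≤-trans n≤n' n'≤b) }

subdivide-counter : ∀ n es → n ≤ proj₁ (subdivide n es)
subdivide-counter n []            = ≤-refl
subdivide-counter n ((a , b) ∷ es) with subdivide (suc n) es | subdivide-counter (suc n) es
... | m , _ | sn≤m = ≤-trans (n≤1+n n) sn≤m

subdivide-below : ∀ n es → Below n es → Below (proj₁ (subdivide n es)) (proj₂ (subdivide n es))
subdivide-below n []             [] = []
subdivide-below n ((a , b) ∷ es) ((a<n , b<n) ∷ below)
  with subdivide (suc n) es | subdivide-counter (suc n) es
     | subdivide-below (suc n) es (below-weaken (n≤1+n n) below)
... | m , _ | n<m | below' = (<-trans a<n n<m , n<m) ∷ (n<m , <-trans b<n n<m) ∷ below'

subdivide-touches : ∀ n es → Touches n (proj₂ (subdivide n es))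
subdivide-touches n []             = []
subdivide-touches n ((a , b) ∷ es) with subdivide (suc n) es | subdivide-touches (suc n) es
... | _ , _ | touches = inj₂ ≤-refl ∷ inj₁ ≤-refl ∷ touches-weaken (n≤1+n n) touches

subdivide-walk : ∀ n x es y → Walk x es y → Walk x (proj₂ (subdivide n es)) y
subdivide-walk n x []             y x≡y = x≡y
subdivide-walk n x ((a , b) ∷ es) y (x≡a , walk)
  with subdivide (suc n) es | subdivide-walk (suc n) b es y walk
... | _ , _ | walk' = x≡a , refl , walk'

subdivide-avoidsσ : ∀ n es → n ≢ σ → All Avoidsσ es → All Avoidsσ (proj₂ (subdivide n es))
subdivide-avoidsσ n []             n≢σ [] = []
subdivide-avoidsσ n ((a , b) ∷ es) n≢σ ((a≢σ , b≢σ) ∷ avoid)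
  with subdivide (suc n) es | subdivide-avoidsσ (suc n) es (λ ()) avoid
... | _ , _ | avoid' = (a≢σ , n≢σ) ∷ (n≢σ , b≢σ) ∷ avoid'

subdivide-σOnlyFirst : ∀ n es → n ≢ σ → σOnlyFirst es → σOnlyFirst (proj₂ (subdivide n es))
subdivide-σOnlyFirst n ((a , b) ∷ es) n≢σ (b≢σ , avoid)
  with subdivide (suc n) es | subdivide-avoidsσ (suc n) es (λ ()) avoid
... | _ , _ | avoid' = n≢σ , (n≢σ , b≢σ) ∷ avoid'

counter : ℕ → ℕ
counter i = proj₁ (stage i)

counter-mono : ∀ {i j} → i ≤′ j → counter i ≤ counter j
counter-mono ≤′-refl        = ≤-refl
counter-mono {j = suc j} (≤′-step i≤′j) =
  ≤-trans (counter-mono i≤′j) (subdivide-counter (counter j) (B j))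

-- Fresh vertices are never σ, since the counter starts at 2.
counter≢σ : ∀ i → counter i ≢ σ
counter≢σ i counter≡σ with subst (2 ≤_) counter≡σ (counter-mono {0} {i} (≤⇒≤′ z≤n))
... | ()

below-B : ∀ i → Below (counter i) (B i)
below-B zero    = (s≤s z≤n , s≤s (s≤s z≤n)) ∷ []
below-B (suc i) = subdivide-below (counter i) (B i) (below-B i)

walk-B : ∀ i → Walk σ (B i) τ
walk-B zero    = refl , refl
walk-B (suc i) = subdivide-walk (counter i) σ (B i) τ (walk-B i)

σOnlyFirst-B : ∀ i → σOnlyFirst (B i)
σOnlyFirst-B zero    = (λ ()) , []
σOnlyFirst-B (suc i) = subdivide-σOnlyFirst (counter i) (B i) (counter≢σ i) (σOnlyFirst-B i)

-- Boundaries are disjoint: an edge of B i lies below counter i, while every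
-- edge of a later boundary B j touches a vertex numbered ≥ counter (j-1) ≥ counter i.
boundaries-disjoint : ∀ {i j e} → i < j → e ∈ B i → e ∈ B j → ⊥
boundaries-disjoint {i} {suc j} (s≤s i≤j) e∈Bi e∈Bj
  with All.lookup (below-B i) e∈Bi | All.lookup (subdivide-touches (counter j) (B j)) e∈Bj
... | a<ci , _    | inj₁ cj≤a = <-irrefl refl (<-≤-trans a<ci (≤-trans (counter-mono (≤⇒≤′ i≤j)) cj≤a))
... | _    , b<ci | inj₂ cj≤b = <-irrefl refl (<-≤-trans b<ci (≤-trans (counter-mono (≤⇒≤′ i≤j)) cj≤b))

edge-≟ : DecidableEquality Edge
edge-≟ = ≡-dec _≟_ _≟_

open import Data.List.Membership.DecPropositional edge-≟ using (_∈?_)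

open DisjointFamily edge-≟ (λ j e → e ∈ B j) boundaries-disjoint

Bq⊆edges : ∀ q {e} → e ∈ B q → e ∈ edges q
Bq⊆edges zero    e∈B = e∈B
Bq⊆edges (suc q) e∈B = ∈-++⁺ʳ (edges q) e∈B

B⊆edges : ∀ {i q e} → i ≤′ q → e ∈ B i → e ∈ edges q
B⊆edges {i} ≤′-refl        e∈Bi = Bq⊆edges i e∈Bi
B⊆edges     (≤′-step i≤′q) e∈Bi = ∈-++⁺ˡ (B⊆edges i≤′q e∈Bi)

edges⊆B : ∀ q {e} → e ∈ edges q → ∃ λ j → j ≤ q × e ∈ B j
edges⊆B zero    e∈E = zero , z≤n , e∈E
edges⊆B (suc q) e∈E with ∈-++⁻ (edges q) e∈E
... | inj₂ e∈B = suc q , ≤-refl , e∈B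
... | inj₁ e∈E' with edges⊆B q e∈E'
...   | j , j≤q , e∈Bj = j , m≤n⇒m≤1+n j≤q , e∈Bj

walk-survives-or-hits : ∀ {E C} x es y → Walk x es y → (∀ {e} → e ∈ es → e ∈ E) →
                        Reach E C x y ⊎ ∃ λ e → e ∈ es × e ∈ C
walk-survives-or-hits x []             y refl es⊆E = inj₁ here
walk-survives-or-hits {E} {C} x ((a , b) ∷ es) y (refl , walk) es⊆E
  with (a , b) ∈? C
... | yes ab∈C = inj₂ ((a , b) , here refl , ab∈C)
... | no  ab∉C with walk-survives-or-hits {E} {C} b es y walk (λ e∈es → es⊆E (there e∈es))
...   | inj₁ reach          = inj₁ (fwd (es⊆E (here refl)) ab∉C reach)
...   | inj₂ (e , e∈es , e∈C) = inj₂ (e , there e∈es , e∈C)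

-- Each boundary is a σ-τ walk in △_q, so a cut contains one of its edges.
cut-meets-boundaries : ∀ {q C} → IsCut q C → Meets (suc q) C
cut-meets-boundaries {q} {C} (_ , _ , disconnected) j j<1+q
  with walk-survives-or-hits {edges q} {C} σ (B j) τ (walk-B j) (B⊆edges (≤⇒≤′ (s≤s⁻¹ j<1+q)))
... | inj₁ reach            = ⊥-elim (disconnected reach)
... | inj₂ (e , e∈Bj , e∈C) = e , e∈C , e∈Bj

-- The first edge of a list (the default is never used: boundaries are nonempty).
first : List Edge → Edge
first []      = σ , σ
first (e ∷ _) = e

first∈B : ∀ i → first (B i) ∈ B i
first∈B i with B i | σOnlyFirst-B i
... | e ∷ _ | _ = here refl

σ-edge-is-first : ∀ i {x y} → (x , y) ∈ B i → x ≡ σ ⊎ y ≡ σ → (x , y) ≡ first (B i)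
σ-edge-is-first i xy∈B touches with B i | σOnlyFirst-B i
... | _ ∷ _ | _ , avoid with xy∈B
...   | here xy≡first = xy≡first
...   | there xy∈rest with All.lookup avoid xy∈rest | touches
...     | x≢σ , _ | inj₁ x≡σ = ⊥-elim (x≢σ x≡σ)
...     | _ , y≢σ | inj₂ y≡σ = ⊥-elim (y≢σ y≡σ)

-- The edges at σ in △_q: the first edges of B q, …, B 0.
star : ℕ → List Edge
star zero    = first (B 0) ∷ []
star (suc q) = first (B (suc q)) ∷ star q

star-length : ∀ q → length (star q) ≡ suc q
star-length zero    = refl
star-length (suc q) = cong suc (star-length q)

∈star⁺ : ∀ {j q} → j ≤′ q → first (B j) ∈ star q
∈star⁺ {q = zero}  ≤′-refl        = here refl
∈star⁺ {q = suc q} ≤′-refl        = here refl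
∈star⁺ {q = suc q} (≤′-step j≤′q) = there (∈star⁺ j≤′q)

∈star⁻ : ∀ q {e} → e ∈ star q → ∃ λ j → j ≤ q × e ≡ first (B j)
∈star⁻ zero    (here e≡) = zero , z≤n , e≡
∈star⁻ (suc q) (here e≡) = suc q , ≤-refl , e≡
∈star⁻ (suc q) (there e∈) with ∈star⁻ q e∈
... | j , j≤q , e≡ = j , m≤n⇒m≤1+n j≤q , e≡

star-unique : ∀ q → Unique (star q)
star-unique zero    = [] ∷ []
star-unique (suc q) = All.tabulate new ∷ star-unique q
  where
  new : ∀ {e} → e ∈ star q → first (B (suc q)) ≢ e
  new e∈star refl with ∈star⁻ q e∈star
  ... | j , j≤q , e≡ =
    boundaries-disjoint (s≤s j≤q) (subst (_∈ B j) (sym e≡) (first∈B j)) (first∈B (suc q))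

-- Every σ-τ walk starts with an edge at σ, and all of these are removed.
star-cut : ∀ q → IsCut q (star q)
star-cut q = star-unique q , star⊆edges , disconnected
  where
  star⊆edges : ∀ {e} → e ∈ star q → e ∈ edges q
  star⊆edges e∈star with ∈star⁻ q e∈star
  ... | j , j≤q , refl = B⊆edges (≤⇒≤′ j≤q) (first∈B j)
  σ-edge∈star : ∀ {x y} → (x , y) ∈ edges q → x ≡ σ ⊎ y ≡ σ → (x , y) ∈ star q
  σ-edge∈star xy∈E touches with edges⊆B q xy∈E
  ... | j , j≤q , xy∈Bj =
    subst (_∈ star q) (sym (σ-edge-is-first j xy∈Bj touches)) (∈star⁺ (≤⇒≤′ j≤q))
  disconnected : ¬ Reach (edges q) (star q) σ τ
  disconnected (fwd xy∈E xy∉star _) = xy∉star (σ-edge∈star xy∈E (inj₁ refl))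
  disconnected (bwd yx∈E yx∉star _) = yx∉star (σ-edge∈star yx∈E (inj₂ refl))

-- Comparing with the star, a minimum cut has at most q+1 edges.
min-cut-size : ∀ {q C} → IsMinCut q C → length C ≤ suc q
min-cut-size {q} (_ , minimal) = subst (_ ≤_) (star-length q) (minimal (star q) (star-cut q))

corollary5 : (q : ℕ) (C : List Edge) → IsMinCut q C →
    (i : ℕ) → i ≤ q → ExactlyOneOf C (B i)
corollary5 q C min@(cut , _) i i≤q with cut-meets-boundaries cut i (s≤s i≤q)
... | e , e∈C , e∈Bi = e , e∈C , e∈Bi , λ e'∈C e'∈Bi →
  tight⇒single (suc q) C (cut-meets-boundaries cut) (min-cut-size min)
               (s≤s i≤q) e∈C e∈Bi e'∈C e'∈Bi
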